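{- Let $\mathsf{M}^*$ be an implicit knowledge-based HMS model with derived explicit possibility correspondences $\Pi^*_i$. For any individual $i\in I$ and all $\omega,\omega'\in\Omega$: (a) if $\omega'\in\Lambda^*_i(\omega)$ then $\Pi^*_i(\omega')=\Pi^*_i(\omega)$; (b) if $\omega'\in\Pi^*_i(\omega)$ then $\Lambda^*_i(\omega')=\Lambda^*_i(\omega)_{S_{\Pi^*_i(\omega)}}$.
   Context: Fix a non-empty set $\mathsf{At}$. An implicit knowledge-based HMS model $\langle I,\{S_\Phi\},(r^\Phi_\Psi),(\Lambda^*_i),(\alpha_i),v\rangle$: $I\ne\emptyset$; non-empty pairwise disjoint spaces $S_\Phi$ ($\Phi\subseteq\mathsf{At}$), ordered $S_{\Phi'}\succeq S_\Phi$ iff $\Phi\subseteq\Phi'$; $\Omega=\bigcup_\Phi S_\Phi$; surjections $r^\Phi_\Psi:S_\Phi\to S_\Psi$ ($\Psi\subseteq\Phi$), $r^\Phi_\Phi=\mathrm{id}$, $r^\Phi_\Upsilon=r^\Psi_\Upsilon\circ r^\Phi_\Psi$; $\omega_\Psi=r^\Phi_\Psi(\omega)$; for $D\subseteq S_\Phi$, $D_\Psi=D_{S_\Psi}=r^\Phi_\Psi(D)$; $v$ a valuation of atoms by events. $\Lambda^*_i:\Omega\to2^\Omega\setminus\{\emptyset\}$ satisfies Reflexivity ($\omega\in\Lambda^*_i(\omega)$), Stationarity ($\omega'\in\Lambda^*_i(\omega)\Rightarrow\Lambda^*_i(\omega')=\Lambda^*_i(\omega)$), Projections Preserve Implicit Knowledge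 ($\omega\in S_\Phi$, $\Psi\subseteq\Phi\Rightarrow\Lambda^*_i(\omega)_\Psi=\Lambda^*_i(\omega_\Psi)$). $\alpha_i:\Omega\to\{S_\Phi\}$ satisfies (O) $\omega\in S_\Phi\Rightarrow\alpha_i(\omega)\preceq S_\Phi$; (I) $\omega'\in\Lambda^*_i(\omega)\Rightarrow\alpha_i(\omega')=\alpha_i(\omega)$; (II) $\omega\in S_\Phi$, $S_\Psi\preceq\alpha_i(\omega)\Rightarrow\alpha_i(\omega_\Psi)=S_\Psi$; (III) $\omega\in S_\Phi$, $\alpha_i(\omega)\preceq S_\Psi\preceq S_\Phi\Rightarrow\alpha_i(\omega_\Psi)=\alpha_i(\omega)$; (IV) $\omega\in S_\Phi$, $\Psi\subseteq\Phi\Rightarrow\alpha_i(\omega)\succeq\alpha_i(\omega_\Psi)$. Derived explicit possibility correspondence: $\Pi^*_i(\omega_\Phi):=\Lambda^*_i(\omega)_{\alpha_i(\omega_\Phi)}$ for all $\omega\in\Omega$, $\Phi\subseteq\mathsf{At}$ (with $\omega_\Phi$ defined); $S_{\Pi^*_i(\omega)}$ denotes the space containing $\Pi^*_i(\omega)$. -}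

module Defs where

open import Level using (0ℓ)
open import Data.Bool using (Bool; T)
open import Data.Product using (Σ; Σ-syntax; _×_; _,_; proj₁; proj₂)
open import Relation.Binary.PropositionalEquality using (_≡_)
open import Relation.Unary using (Pred; _≐_; _∈_)

Sub : Set → Set
Sub At = At → Bool

_⊆ᴬ_ : {At : Set} → Sub At → Sub At → Set
Ψ ⊆ᴬ Φ = ∀ a → T (Ψ a) → T (Φ a)

image : {A B : Set} → (A → B) → Pred A 0ℓ → Pred B 0ℓ
image {A} f D y = Σ[ x ∈ A ] (x ∈ D × f x ≡ y)

-- Space S Φ is the space S_Φ; Ω = Σ Φ, S Φ (so the spaces are pairwise disjoint).
-- S_Φ' ⪰ S_Φ iff Φ ⊆ Φ'.  r p : S Φ → S Ψ is r^Φ_Ψ (p : Ψ ⊆ Φ, proof-irrelevant).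
-- Λ i ω ⊆ S_Φ for ω ∈ S_Φ (implicit knowledge stays in ω's own space).
record HMS (At : Set) : Set₁ where
  field
    At-nonempty : At
    Agent       : Set
    Agent-nonempty : Agent
    Space       : Sub At → Set
    Space-nonempty : ∀ Φ → Space Φ
    r       : ∀ {Φ Ψ} → .(Ψ ⊆ᴬ Φ) → Space Φ → Space Ψ
    r-surj  : ∀ {Φ Ψ} .(p : Ψ ⊆ᴬ Φ) (y : Space Ψ) → Σ[ x ∈ Space Φ ] r p x ≡ y
    r-id    : ∀ {Φ} .(p : Φ ⊆ᴬ Φ) (x : Space Φ) → r p x ≡ x
    r-comp  : ∀ {Φ Ψ Υ} .(p : Ψ ⊆ᴬ Φ) .(q : Υ ⊆ᴬ Ψ) .(pq : Υ ⊆ᴬ Φ) (x : Space Φ) →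
              r pq x ≡ r q (r p x)
    -- valuation of atoms (event structure irrelevant here)
    v       : At → Pred (Σ (Sub At) Space) 0ℓ
    Λ       : Agent → ∀ {Φ} → Space Φ → Pred (Space Φ) 0ℓ
    Λ-nonempty : ∀ i {Φ} (x : Space Φ) → Σ[ y ∈ Space Φ ] y ∈ Λ i x
    Λ-refl  : ∀ i {Φ} (x : Space Φ) → x ∈ Λ i x
    Λ-stat  : ∀ i {Φ} (x y : Space Φ) → y ∈ Λ i x → Λ i y ≐ Λ i x
    Λ-proj  : ∀ i {Φ Ψ} .(p : Ψ ⊆ᴬ Φ) (x : Space Φ) →
              image (r p) (Λ i x) ≐ Λ i (r p x)
    α       : Agent → ∀ {Φ} → Space Φ → Sub At
    α-O     : ∀ i {Φ} (x : Space Φ) → α i x ⊆ᴬ Φ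
    α-I     : ∀ i {Φ} (x y : Space Φ) → y ∈ Λ i x → α i y ≡ α i x
    α-II    : ∀ i {Φ Ψ} (x : Space Φ) .(p : Ψ ⊆ᴬ Φ) → Ψ ⊆ᴬ α i x → α i (r p x) ≡ Ψ
    α-III   : ∀ i {Φ Ψ} (x : Space Φ) .(p : Ψ ⊆ᴬ Φ) → α i x ⊆ᴬ Ψ →
              α i (r p x) ≡ α i x
    α-IV    : ∀ i {Φ Ψ} (x : Space Φ) .(p : Ψ ⊆ᴬ Φ) → α i (r p x) ⊆ᴬ α i x

  Ω : Set
  Ω = Σ (Sub At) Space

  ⟦_⟧ : ∀ {Φ} → Pred (Space Φ) 0ℓ → Pred Ω 0ℓ
  ⟦_⟧ {Φ} D = image (λ (x : Space Φ) → (Φ , x)) D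

  Λ* : Agent → Ω → Pred Ω 0ℓ
  Λ* i (Φ , x) = ⟦ Λ i x ⟧

  Πsp : (i : Agent) → (ω : Ω) → Pred (Space (α i (proj₂ ω))) 0ℓ
  Πsp i (Φ , x) = image (r (α-O i x)) (Λ i x)

  Π* : Agent → Ω → Pred Ω 0ℓ
  Π* i ω = ⟦ Πsp i ω ⟧

  -- S_{Π*_i(ω)}: the space containing Π*_i(ω) (nonempty subset of S_{α_i(ω)})
  SΠ* : Agent → Ω → Sub At
  SΠ* i ω = α i (proj₂ ω)

  projSet : ∀ {Φ Ψ} → .(Ψ ⊆ᴬ Φ) → Pred (Space Φ) 0ℓ → Pred (Space Ψ) 0ℓ
  projSet p D = image (r p) D

  Λ*proj : Agent → (ω : Ω) → (Ψ : Sub At) → .(Ψ ⊆ᴬ proj₁ ω) → Pred Ω 0ℓ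
  Λ*proj i ω Ψ p = ⟦ projSet {proj₁ ω} {Ψ} p (Λ i (proj₂ ω)) ⟧

module Submission where

open import Level using (0ℓ)
open import Data.Product using (_×_; _,_; proj₂)
open import Relation.Unary using (Pred; _⊆_; _≐_; _∈_)
open import Relation.Unary.Properties using (≐-sym; ≐-trans)
open import Relation.Binary.PropositionalEquality using (_≡_; refl)
open import Defs

-- Both parts reduce to one observation: Π*_i(ω) = Λ*_i(ω)_{α_i(ω)} is determined by the
-- pair (α_i(ω), Λ_i(ω)).  For (a), Stationarity and (I) make this pair constant on Λ_i(ω).
-- For (b), an ω' ∈ Π*_i(ω) is the projection of some w ∈ Λ_i(ω); Projections Preserve
-- Implicit Knowledge gives Λ_i(ω') = Λ_i(w)_{α_i(ω)}, and Stationarity gives Λ_i(w) = Λ_i(ω).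

image-mono : {A B : Set} (f : A → B) {D E : Pred A 0ℓ} → D ⊆ E → image f D ⊆ image f E
image-mono f D⊆E (x , x∈D , fx≡y) = x , D⊆E x∈D , fx≡y

image-cong : {A B : Set} (f : A → B) {D E : Pred A 0ℓ} → D ≐ E → image f D ≐ image f E
image-cong f (D⊆E , E⊆D) = image-mono f D⊆E , image-mono f E⊆D

module _ {At : Set} (M : HMS At) where
  open HMS M

  ⟦⟧-cong : ∀ {Φ} {D E : Pred (Space Φ) 0ℓ} → D ≐ E → ⟦ D ⟧ ≐ ⟦ E ⟧
  ⟦⟧-cong = image-cong _

  -- The target spaces S_Ψ and S_Ψ' are only propositionally equal, so the images live in
  -- different types; they are compared inside Ω.
  ⟦projSet⟧-cong : ∀ {Φ Ψ Ψ'} → Ψ ≡ Ψ' → .(p : Ψ ⊆ᴬ Φ) .(p' : Ψ' ⊆ᴬ Φ)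
                   {D E : Pred (Space Φ) 0ℓ} → D ≐ E →
                   ⟦ projSet p D ⟧ ≐ ⟦ projSet p' E ⟧
  ⟦projSet⟧-cong refl p p' D≐E = ⟦⟧-cong (image-cong (r p) D≐E)

  Π*-constant-on-Λ* : (i : Agent) (ω ω' : Ω) → ω' ∈ Λ* i ω → Π* i ω' ≐ Π* i ω
  Π*-constant-on-Λ* i (Φ , x) .(Φ , y) (y , y∈Λx , refl) =
    ⟦projSet⟧-cong (α-I i x y y∈Λx) (α-O i y) (α-O i x) (Λ-stat i x y y∈Λx)

  Λ*-on-Π* : (i : Agent) (ω ω' : Ω) → ω' ∈ Π* i ω →
             Λ* i ω' ≐ Λ*proj i ω (SΠ* i ω) (α-O i (proj₂ ω))
  Λ*-on-Π* i (Φ , x) .(α i x , r _ w) (.(r _ w) , (w , w∈Λx , refl) , refl) =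
    ⟦⟧-cong (≐-trans (≐-sym (Λ-proj i p w)) (image-cong (r p) (Λ-stat i x w w∈Λx)))
    where
      p : α i x ⊆ᴬ Φ
      p = α-O i x

lemma13 : {At : Set} (M : HMS At) → let open HMS M in
    (i : Agent) (ω ω' : Ω) →
      (ω' ∈ Λ* i ω → Π* i ω' ≐ Π* i ω)
      × (ω' ∈ Π* i ω → Λ* i ω' ≐ Λ*proj i ω (SΠ* i ω) (α-O i (proj₂ ω)))
lemma13 M i ω ω' = Π*-constant-on-Λ* M i ω ω' , Λ*-on-Π* M i ω ω'
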